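{- Let $p<q$ be relatively prime integers greater than $1$ and let $N=\lfloor\log_p(q-\frac{q-1}{p})\rfloor$. For all $U,c\in\mathbb{N}$, if $\delta_{p,q}(c,U)=1$ then $\delta_{p,q}(c+k,U)=0$ for all integers $k$ with $k\ge -c$ and $0<|k|\le N$.
   Context: $W_p(n)\in\{0,1\}$ equals $1$ iff the nonnegative integer $n$ has a base-$p$ expansion using only the digits $0$ and $1$ (in particular $W_p(0)=1$). For $c,U\in\mathbb{N}$, $\delta_{p,q}(c,U)=1$ if $\lfloor U/p^c\rfloor\equiv1\pmod q$ and $W_p(U\bmod p^c)=1$, and $\delta_{p,q}(c,U)=0$ otherwise. -}

module Defs where

open import Data.Nat using (ℕ; zero; suc; _^_; _≡ᵇ_; _≤ᵇ_; NonZero)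
open import Data.Nat.DivMod using (_/_; _%_)
open import Data.Nat.Properties using (m^n≢0)
open import Data.Bool using (Bool; true; false; _∧_; if_then_else_)

-- Fuel-based check that every base-p digit of n is 0 or 1.
-- With p ≥ 2, fuel n always suffices (n/p < n for n > 0).
Wᵇ-fuel : (fuel p : ℕ) .{{_ : NonZero p}} → ℕ → Bool
Wᵇ-fuel zero    p n       = n ≡ᵇ 0
Wᵇ-fuel (suc f) p zero    = true
Wᵇ-fuel (suc f) p (suc n) = ((suc n % p) ≤ᵇ 1) ∧ Wᵇ-fuel f p (suc n / p)

W : (p : ℕ) .{{_ : NonZero p}} → ℕ → ℕ
W p n = if Wᵇ-fuel n p n then 1 else 0

δ : (p q : ℕ) .{{_ : NonZero p}} .{{_ : NonZero q}} → ℕ → ℕ → ℕ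
δ p q c U =
  if ((((U / (p ^ c)) {{m^n≢0 p c}}) % q) ≡ᵇ (1 % q)) ∧ (W p ((U % (p ^ c)) {{m^n≢0 p c}}) ≡ᵇ 1)
  then 1 else 0

module Submission where

-- Write Y = ⌊U/pᶜ⌋.  If δ(c,U) = δ(c+j,U) = 1 with j ≥ 1, split
-- Y = s + Z·pʲ where Z = ⌊U/p^(c+j)⌋ and s = Y mod pʲ.  Both Y and Z are ≡ 1
-- (mod q), hence X = s + pʲ ≡ 1 (mod q).  But s is formed by the base-p digits
-- of U mod p^(c+j) in positions c, …, c+j-1, which are all 0 or 1, so
-- s·(p-1) < pʲ and therefore X·(p-1) < p^(j+1) ≤ p^(N+1) ≤ q(p-1) + 1, i.e.
-- X ≤ q.  But no X with 2 ≤ X ≤ q is ≡ 1 (mod q).  A negative shift k is the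
-- same situation with the roles of c and c+k exchanged.

open import Defs
open import Data.Nat using (ℕ; _<_; _≤_; _*_; _∸_; _^_; _+_; NonZero)
open import Data.Nat.Coprimality using (Coprime)
open import Data.Integer using (ℤ; +_; -_; ∣_∣) renaming (_+_ to _+ℤ_; _≤_ to _≤ℤ_)
open import Relation.Binary.PropositionalEquality using (_≡_)

open import Data.Nat using (zero; suc; z≤n; s≤s; _≡ᵇ_; _≤ᵇ_)
open import Data.Nat.Properties
open import Data.Nat.DivMod
open import Data.Nat.Solver using (module +-*-Solver)
open import Data.Bool using (true; false; _∧_; if_then_else_; T)
open import Data.Bool.Properties using (T-∧)
open import Data.Empty using (⊥)
open import Data.Product using (_×_; _,_; proj₁; proj₂)
open import Data.Sum using (inj₁; inj₂)
open import Function using (_∘_)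
open import Function.Bundles using (Equivalence)
open import Relation.Nullary using (¬_)
open import Relation.Binary.PropositionalEquality
  using (refl; sym; trans; cong; subst; module ≡-Reasoning)
import Data.Integer as ℤ
import Data.Integer.Properties as ℤ

indicator≡1 : ∀ b → (if b then 1 else 0) ≡ 1 → T b
indicator≡1 true _ = _

indicator≡0 : ∀ b → ¬ T b → (if b then 1 else 0) ≡ 0
indicator≡0 false _   = refl
indicator≡0 true  ¬tt with ¬tt _
... | ()

unit-multiple : ∀ q .{{_ : NonZero q}} Z P → Z % q ≡ 1 % q → (Z * P) % q ≡ P % q
unit-multiple q Z P Z≡1 = begin
    (Z * P) % q               ≡⟨ %-distribˡ-* Z P q ⟩
    (Z % q * (P % q)) % q     ≡⟨ cong (λ t → (t * (P % q)) % q) Z≡1 ⟩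
    (1 % q * (P % q)) % q     ≡⟨ %-distribˡ-* 1 P q ⟨
    (1 * P) % q               ≡⟨ cong (_% q) (*-identityˡ P) ⟩
    P % q                     ∎
  where open ≡-Reasoning

residue-shift : ∀ q .{{_ : NonZero q}} Y Z s P → Y ≡ s + Z * P →
                Y % q ≡ 1 % q → Z % q ≡ 1 % q → (s + P) % q ≡ 1 % q
residue-shift q Y Z s P Y≡ Y≡1 Z≡1 = begin
    (s + P) % q               ≡⟨ %-distribˡ-+ s P q ⟩
    (s % q + P % q) % q       ≡⟨ cong (λ t → (s % q + t) % q) (unit-multiple q Z P Z≡1) ⟨
    (s % q + Z * P % q) % q   ≡⟨ %-distribˡ-+ s (Z * P) q ⟨
    (s + Z * P) % q           ≡⟨ cong (_% q) Y≡ ⟨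
    Y % q                     ≡⟨ Y≡1 ⟩
    1 % q                     ∎
  where open ≡-Reasoning

no-unit-residue : ∀ q X .{{_ : NonZero q}} → 1 < q → 2 ≤ X → X ≤ q → X % q ≡ 1 % q → ⊥
no-unit-residue q X 1<q 2≤X X≤q X≡1 with m≤n⇒m<n∨m≡n X≤q
... | inj₁ X<q = <⇒≢ 2≤X (sym X≡1′)
  where
  X≡1′ : X ≡ 1
  X≡1′ = trans (sym (m<n⇒m%n≡m X<q)) (trans X≡1 (m<n⇒m%n≡m 1<q))
... | inj₂ refl with trans (sym (n%n≡0 X)) (trans X≡1 (m<n⇒m%n≡m 1<q))
...   | ()

expand-digit : ∀ d m p p₁ → (d + m * p) * p₁ ≡ d * p₁ + p * (m * p₁)
expand-digit = solve 4 (λ d m p p₁ → (d :+ m :* p) :* p₁ := d :* p₁ :+ p :* (m :* p₁)) refl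
  where open +-*-Solver

module Base (p₂ : ℕ) where

  p p₁ : ℕ
  p  = suc (suc p₂)
  p₁ = suc p₂

  p^≢0 : ∀ c → NonZero (p ^ c)
  p^≢0 c = m^n≢0 p c

  infixl 7 _/^_ _%^_
  _/^_ _%^_ : ℕ → ℕ → ℕ
  U /^ c = (U / p ^ c) {{p^≢0 c}}
  U %^ c = (U % p ^ c) {{p^≢0 c}}

  threshold : ∀ q .{{_ : NonZero q}} → p * q ∸ (q ∸ 1) ≡ suc (q * p₁)
  threshold (suc q₁) = begin
      suc q₁ + x ∸ q₁    ≡⟨ cong (_∸ q₁) (+-suc q₁ x) ⟨
      q₁ + suc x ∸ q₁    ≡⟨ m+n∸m≡n q₁ (suc x) ⟩
      suc x              ≡⟨ cong suc (*-comm p₁ (suc q₁)) ⟩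
      suc (suc q₁ * p₁)  ∎
    where
    open ≡-Reasoning
    x = p₁ * suc q₁

  shift-shift : ∀ U c j → U /^ c /^ j ≡ U /^ (c + j)
  shift-shift U c j = trans (m/n/o≡m/[n*o] U (p ^ c) (p ^ j))
                            (/-congʳ (sym (^-distribˡ-+-* p c j)))
    where instance _ = p^≢0 c; _ = p^≢0 j; _ = p^≢0 (c + j); _ = m*n≢0 (p ^ c) (p ^ j)

  digit-window : ∀ U c j → U %^ (c + j) /^ c ≡ U /^ c %^ j
  digit-window U c j = trans (/-congˡ (%-congʳ p^[c+j]≡p^j*p^c)) (m%[n*o]/o≡m/o%n U (p ^ j) (p ^ c))
    where
    instance _ = p^≢0 c; _ = p^≢0 j; _ = p^≢0 (c + j); _ = m*n≢0 (p ^ j) (p ^ c)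
    p^[c+j]≡p^j*p^c : p ^ (c + j) ≡ p ^ j * p ^ c
    p^[c+j]≡p^j*p^c = trans (^-distribˡ-+-* p c j) (*-comm (p ^ c) (p ^ j))

  /p≤ : ∀ n → suc n / p ≤ n
  /p≤ n = <⇒≤pred (m/n<m (suc n) p (s≤s (s≤s z≤n)))

  fuel-irrelevant : ∀ f g n → n ≤ f → n ≤ g → Wᵇ-fuel f p n ≡ Wᵇ-fuel g p n
  fuel-irrelevant zero    zero    n       _       _       = refl
  fuel-irrelevant zero    (suc g) zero    _       _       = refl
  fuel-irrelevant (suc f) zero    zero    _       _       = refl
  fuel-irrelevant (suc f) (suc g) zero    _       _       = refl
  fuel-irrelevant (suc f) (suc g) (suc n) (s≤s n≤f) (s≤s n≤g) =
    cong ((suc n % p ≤ᵇ 1) ∧_) (fuel-irrelevant f g (suc n / p) (≤-trans (/p≤ n) n≤f) (≤-trans (/p≤ n) n≤g))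

  ZeroOne : ℕ → Set
  ZeroOne n = T (Wᵇ-fuel n p n)

  last-digit≤1 : ∀ n → ZeroOne n → n % p ≤ 1
  last-digit≤1 zero    _  = z≤n
  last-digit≤1 (suc n) zo = ≤ᵇ⇒≤ (suc n % p) 1 (proj₁ (Equivalence.to T-∧ zo))

  ZeroOne-/p : ∀ n → ZeroOne n → ZeroOne (n / p)
  ZeroOne-/p zero    zo = zo
  ZeroOne-/p (suc n) zo = subst T (fuel-irrelevant n (suc n / p) (suc n / p) (/p≤ n) ≤-refl) rest
    where
    rest : T (Wᵇ-fuel n p (suc n / p))
    rest = proj₂ (Equivalence.to T-∧ zo)

  ZeroOne-/^ : ∀ i n → ZeroOne n → ZeroOne (n /^ i)
  ZeroOne-/^ zero    n zo = subst ZeroOne (sym (n/1≡n n)) zo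
  ZeroOne-/^ (suc i) n zo =
    subst ZeroOne (m/n/o≡m/[n*o] n p (p ^ i) {{_}} {{p^≢0 i}} {{p^≢0 (suc i)}})
          (ZeroOne-/^ i (n / p) (ZeroOne-/p n zo))

  -- A number below pᶜ with digits 0/1 is at most 1 + p + … + p^(c-1), i.e. n·(p-1) < pᶜ.
  ZeroOne-bound : ∀ c n → ZeroOne n → n < p ^ c → n * p₁ < p ^ c
  ZeroOne-bound zero    zero    _  _        = s≤s z≤n
  ZeroOne-bound zero    (suc n) _  (s≤s ())
  ZeroOne-bound (suc c) n       zo n<p^1+c = begin-strict
      n * p₁                 ≡⟨ cong (_* p₁) (m≡m%n+[m/n]*n n p) ⟩
      (d + m * p) * p₁       ≡⟨ expand-digit d m p p₁ ⟩
      d * p₁ + p * (m * p₁)  <⟨ +-monoˡ-< (p * (m * p₁)) d*p₁<p ⟩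
      p + p * (m * p₁)       ≡⟨ *-suc p (m * p₁) ⟨
      p * suc (m * p₁)       ≤⟨ *-monoʳ-≤ p (ZeroOne-bound c m (ZeroOne-/p n zo) m<p^c) ⟩
      p * p ^ c              ∎
    where
    open ≤-Reasoning
    d = n % p
    m = n / p
    d*p₁<p : d * p₁ < p
    d*p₁<p = ≤-<-trans (*-monoˡ-≤ p₁ (last-digit≤1 n zo)) (≤-reflexive (cong suc (*-identityˡ p₁)))
    m<p^c : m < p ^ c
    m<p^c = m<n*o⇒m/o<n (subst (n <_) (*-comm p (p ^ c)) n<p^1+c)

  small-window : ∀ q s j → ZeroOne s → s < p ^ j → p ^ suc j ≤ suc (q * p₁) → s + p ^ j ≤ q
  small-window q s j zo s<p^j gap = *-cancelʳ-≤ (s + P) q p₁ (<⇒≤pred [s+P]*p₁<)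
    where
    P = p ^ j
    open ≤-Reasoning
    [s+P]*p₁< : (s + P) * p₁ < suc (q * p₁)
    [s+P]*p₁< = begin-strict
      (s + P) * p₁     ≡⟨ *-distribʳ-+ p₁ s P ⟩
      s * p₁ + P * p₁  <⟨ +-monoˡ-< (P * p₁) (ZeroOne-bound j s zo s<p^j) ⟩
      P + P * p₁       ≡⟨ *-suc P p₁ ⟨
      P * p            ≡⟨ *-comm P p ⟩
      p ^ suc j        ≤⟨ gap ⟩
      suc (q * p₁)     ∎

  Marked : (q : ℕ) .{{_ : NonZero q}} → ℕ → ℕ → Set
  Marked q c U = U /^ c % q ≡ 1 % q × ZeroOne (U %^ c)

  condition⇒marked : ∀ q .{{_ : NonZero q}} c U →
                     T ((U /^ c % q ≡ᵇ 1 % q) ∧ (W p (U %^ c) ≡ᵇ 1)) → Marked q c U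
  condition⇒marked q c U t with Equivalence.to T-∧ t
  ... | residue , digits = ≡ᵇ⇒≡ _ _ residue , indicator≡1 _ (≡ᵇ⇒≡ _ _ digits)

  δ-marked : ∀ q .{{_ : NonZero q}} c U → δ p q c U ≡ 1 → Marked q c U
  δ-marked q c U = condition⇒marked q c U ∘ indicator≡1 _

  unmarked-δ : ∀ q .{{_ : NonZero q}} c U → ¬ Marked q c U → δ p q c U ≡ 0
  unmarked-δ q c U unmarked = indicator≡0 _ (unmarked ∘ condition⇒marked q c U)

  -- Core of the argument: marked positions c < c + j are at distance j with
  -- p^(j+1) > q(p-1) + 1.  Writing ⌊U/pᶜ⌋ = s + ⌊U/p^(c+j)⌋·pʲ, the number
  -- X = s + pʲ would be ≡ 1 (mod q) with 2 ≤ X ≤ q.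
  markers-far-apart : ∀ q .{{_ : NonZero q}} c j U → 1 < q → 1 ≤ j →
                      p ^ suc j ≤ suc (q * p₁) → Marked q c U → Marked q (c + j) U → ⊥
  markers-far-apart q c j@(suc i) U 1<q _ gap (Y≡1 , _) (Z≡1 , zo) =
    no-unit-residue q (s + p ^ j) 1<q 2≤X X≤q X≡1
    where
    Y = U /^ c
    Z = U /^ (c + j)
    s = Y %^ j
    Y≡s+Z*pʲ : Y ≡ s + Z * p ^ j
    Y≡s+Z*pʲ = trans (m≡m%n+[m/n]*n Y (p ^ j) {{p^≢0 j}}) (cong (λ t → s + t * p ^ j) (shift-shift U c j))
    X≡1 : (s + p ^ j) % q ≡ 1 % q
    X≡1 = residue-shift q Y Z s (p ^ j) Y≡s+Z*pʲ Y≡1 Z≡1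
    s-digits : ZeroOne s
    s-digits = subst ZeroOne (digit-window U c j) (ZeroOne-/^ c (U %^ (c + j)) zo)
    X≤q : s + p ^ j ≤ q
    X≤q = small-window q s j s-digits (m%n<n Y (p ^ j) {{p^≢0 j}}) gap
    2≤X : 2 ≤ s + p ^ j
    2≤X = ≤-trans 2≤p (≤-trans (m≤m*n p (p ^ i) {{p^≢0 i}}) (m≤n+m (p ^ j) s))
      where
      2≤p : 2 ≤ p
      2≤p = s≤s (s≤s z≤n)

  gap-below : ∀ {B} N j → p ^ (N + 1) ≤ B → j ≤ N → p ^ suc j ≤ B
  gap-below N j p^[N+1]≤B j≤N = ≤-trans (^-monoʳ-≤ p (subst (suc j ≤_) (+-comm 1 N) (s≤s j≤N))) p^[N+1]≤B

  nearby-unmarked : ∀ q .{{_ : NonZero q}} N → 1 < q → p ^ (N + 1) ≤ suc (q * p₁) →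
                    ∀ U c → Marked q c U → (k : ℤ) → - (+ c) ≤ℤ k → 0 < ∣ k ∣ → ∣ k ∣ ≤ N →
                    ¬ Marked q ∣ + c +ℤ k ∣ U
  nearby-unmarked q N 1<q _ U c marked (+ zero) _ () _
  nearby-unmarked q N 1<q below U c marked (+ suc j) _ _ 1+j≤N =
    markers-far-apart q c (suc j) U 1<q (s≤s z≤n) (gap-below N (suc j) below 1+j≤N) marked
  nearby-unmarked q N 1<q _ U zero marked ℤ.-[1+ j ] () _ _
  nearby-unmarked q N 1<q below U (suc c) marked ℤ.-[1+ j ] (ℤ.-≤- j≤c) _ 1+j≤N
    rewrite ℤ.⊖-≥ (s≤s j≤c) = λ marked′ →
    markers-far-apart q (c ∸ j) (suc j) U 1<q (s≤s z≤n) (gap-below N (suc j) below 1+j≤N)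
                      marked′ (subst (λ t → Marked q t U) 1+c≡[c∸j]+[1+j] marked)
    where
    1+c≡[c∸j]+[1+j] : suc c ≡ c ∸ j + suc j
    1+c≡[c∸j]+[1+j] = sym (trans (+-suc (c ∸ j) j) (cong suc (m∸n+n≡m j≤c)))

proposition4p3 : (p q N : ℕ) .{{_ : NonZero p}} .{{_ : NonZero q}} →
  1 < p → p < q → Coprime p q →
  p ^ (N + 1) ≤ p * q ∸ (q ∸ 1) → p * q ∸ (q ∸ 1) < p ^ (N + 2) →
  (U c : ℕ) → δ p q c U ≡ 1 →
  (k : ℤ) → - (+ c) ≤ℤ k → 0 < ∣ k ∣ → ∣ k ∣ ≤ N →
  δ p q ∣ + c +ℤ k ∣ U ≡ 0
proposition4p3 (suc zero) _ _ (s≤s ()) _ _ _ _ _ _ _ _ _ _ _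
proposition4p3 (suc (suc p₂)) q N 1<p p<q _ below _ U c δ≡1 k k≥-c 0<∣k∣ ∣k∣≤N =
  unmarked-δ q ∣ + c +ℤ k ∣ U
    (nearby-unmarked q N 1<q below′ U c (δ-marked q c U δ≡1) k k≥-c 0<∣k∣ ∣k∣≤N)
  where
  open Base p₂
  1<q : 1 < q
  1<q = <-trans 1<p p<q
  below′ : p ^ (N + 1) ≤ suc (q * p₁)
  below′ = subst (p ^ (N + 1) ≤_) (threshold q) below
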